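{- Let $\mathbf L_1=(L,\vee,\wedge,\rightarrow,0,1)$ be an algebra of type $(2,2,2,0,0)$ such that $(L,\vee,\wedge,0,1)$ is a bounded distributive lattice, and put $x^*:=x\rightarrow0$ for all $x\in L$. Then $\mathbf L_2:=(L,\vee,\wedge,{}^*,0,1)$ is a Stone lattice (i.e. $x^*$ is the pseudocomplement of $x$ for every $x$ and the Stone identity holds) if and only if $\mathbf L_1$ satisfies the identities (1) $x\wedge(0\rightarrow0)\approx x$, (2) $x\wedge(x\rightarrow0)\approx0$, (3) $x\wedge\big((x\wedge y)\rightarrow0\big)\approx x\wedge(y\rightarrow0)$, (4) $(x\rightarrow0)\vee\big((x\rightarrow0)\rightarrow0\big)\approx1$.
   Context: In a bounded lattice, $a^*$ is the pseudocomplement of $a$ if it is the greatest element $x$ with $a\wedge x=0$; a lattice is pseudocomplemented if every element has a pseudocomplement. A Stone lattice is a distributive pseudocomplemented lattice $(L,\vee,\wedge,{}^*,0,1)$ satisfying the Stone identity $x^*\vee x^{**}\approx1$. -}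

module Defs where

open import Level using (Level; _⊔_)
open import Algebra.Core using (Op₂)
open import Algebra.Definitions using (Congruent₂)
open import Algebra.Lattice.Bundles using (DistributiveLattice)
open import Data.Product using (_×_)

record BoundedDistributiveLattice (c ℓ : Level) : Set (Level.suc (c ⊔ ℓ)) where
  field
    distributiveLattice : DistributiveLattice c ℓ
  open DistributiveLattice distributiveLattice public
  field
    ⊥ : Carrier
    ⊤ : Carrier
    ∧-zeroˡ : ∀ x → (⊥ ∧ x) ≈ ⊥
    ∧-identityˡ : ∀ x → (⊤ ∧ x) ≈ x

  _≤_ : Carrier → Carrier → Set ℓ
  x ≤ y = (x ∧ y) ≈ x

  IsPseudocomplementOf : Carrier → Carrier → Set (c ⊔ ℓ)
  IsPseudocomplementOf p a = ((a ∧ p) ≈ ⊥) × (∀ x → (a ∧ x) ≈ ⊥ → x ≤ p)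

  IsStoneLattice : (Carrier → Carrier) → Set (c ⊔ ℓ)
  IsStoneLattice _* = (∀ x → IsPseudocomplementOf (x *) x) × (∀ x → ((x *) ∨ ((x *) *)) ≈ ⊤)

-- x* is the pseudocomplement of x exactly when x ∧ z ≈ 0 ⇔ z ≤ x*. Identity
-- (1) is this for x = 0, identity (2) for z = x*, and (3) holds because, below
-- x, being disjoint from y and from x ∧ y are the same condition.
-- Conversely (1)–(3) give z ∧ x* ≈ z ∧ (z ∧ x)* ≈ z ∧ 0* ≈ z whenever
-- x ∧ z ≈ 0. Identity (4) is the Stone identity itself.
module Submission where

open import Defs
open import Level using (_⊔_)
open import Algebra.Core using (Op₁; Op₂)
open import Algebra.Definitions using (Congruent₁; Congruent₂)
open import Data.Product using (_×_; _,_; proj₁; proj₂)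
open import Function.Bundles using (_⇔_; mk⇔)
import Algebra.Lattice.Properties.Lattice as LatticeProperties
import Relation.Binary.Reasoning.Setoid as SetoidReasoning

module MeetOrder {c ℓ} (L : BoundedDistributiveLattice c ℓ) where
  open BoundedDistributiveLattice L
  open LatticeProperties lattice using (∧-idem)
  open SetoidReasoning setoid

  ≤-antisym : ∀ {x y} → x ≤ y → y ≤ x → x ≈ y
  ≤-antisym {x} {y} x≤y y≤x = trans (sym x≤y) (trans (∧-comm x y) y≤x)

  x∧y≤x : ∀ x y → (x ∧ y) ≤ x
  x∧y≤x x y = begin
    (x ∧ y) ∧ x ≈⟨ ∧-comm (x ∧ y) x ⟩
    x ∧ (x ∧ y) ≈⟨ ∧-assoc x x y ⟨
    (x ∧ x) ∧ y ≈⟨ ∧-cong (∧-idem x) refl ⟩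
    x ∧ y       ∎

  x∧y≤y : ∀ x y → (x ∧ y) ≤ y
  x∧y≤y x y = begin
    (x ∧ y) ∧ y ≈⟨ ∧-assoc x y y ⟩
    x ∧ (y ∧ y) ≈⟨ ∧-cong refl (∧-idem y) ⟩
    x ∧ y       ∎

  ∧-greatest : ∀ {x y z} → z ≤ x → z ≤ y → z ≤ (x ∧ y)
  ∧-greatest {x} {y} {z} z≤x z≤y = begin
    z ∧ (x ∧ y) ≈⟨ ∧-assoc z x y ⟨
    (z ∧ x) ∧ y ≈⟨ ∧-cong z≤x refl ⟩
    z ∧ y       ≈⟨ z≤y ⟩
    z           ∎

  ∧-absorbs-≤ : ∀ {x z} y → z ≤ x → ((x ∧ y) ∧ z) ≈ (y ∧ z)
  ∧-absorbs-≤ {x} {z} y z≤x = begin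
    (x ∧ y) ∧ z ≈⟨ ∧-cong (∧-comm x y) refl ⟩
    (y ∧ x) ∧ z ≈⟨ ∧-assoc y x z ⟩
    y ∧ (x ∧ z) ≈⟨ ∧-cong refl (trans (∧-comm x z) z≤x) ⟩
    y ∧ z       ∎

module Pseudocomplement {c ℓ} (L : BoundedDistributiveLattice c ℓ)
                        (_* : Op₁ (BoundedDistributiveLattice.Carrier L)) where
  open BoundedDistributiveLattice L
  open MeetOrder L
  open SetoidReasoning setoid

  IsPseudocomplementation : Set (c ⊔ ℓ)
  IsPseudocomplementation = ∀ x → IsPseudocomplementOf (x *) x

  module _ (pc : IsPseudocomplementation) where

    ∧-pseudocomplement : ∀ x → (x ∧ (x *)) ≈ ⊥
    ∧-pseudocomplement x = proj₁ (pc x)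

    disjoint⇒≤* : ∀ {x z} → (x ∧ z) ≈ ⊥ → z ≤ (x *)
    disjoint⇒≤* {x} {z} = proj₂ (pc x) z

    ≤*⇒disjoint : ∀ {x z} → z ≤ (x *) → (x ∧ z) ≈ ⊥
    ≤*⇒disjoint {x} {z} z≤x* = begin
      x ∧ z             ≈⟨ ∧-cong refl z≤x* ⟨
      x ∧ (z ∧ (x *))   ≈⟨ ∧-cong refl (∧-comm z (x *)) ⟩
      x ∧ ((x *) ∧ z)   ≈⟨ ∧-assoc x (x *) z ⟨
      (x ∧ (x *)) ∧ z   ≈⟨ ∧-cong (∧-pseudocomplement x) refl ⟩
      ⊥ ∧ z             ≈⟨ ∧-zeroˡ z ⟩
      ⊥                 ∎

    ≤⊥* : ∀ x → x ≤ (⊥ *)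
    ≤⊥* x = disjoint⇒≤* (∧-zeroˡ x)

    ∧-pseudocomplement-∧ : ∀ x y → (x ∧ ((x ∧ y) *)) ≈ (x ∧ (y *))
    ∧-pseudocomplement-∧ x y = ≤-antisym
      (∧-greatest (x∧y≤x x _) (restrict (x∧y≤x x _) (x∧y≤y x _)))
      (∧-greatest (x∧y≤x x _) (extend (x∧y≤x x _) (x∧y≤y x _)))
      where
      restrict : ∀ {z} → z ≤ x → z ≤ ((x ∧ y) *) → z ≤ (y *)
      restrict z≤x z≤[x∧y]* =
        disjoint⇒≤* (trans (sym (∧-absorbs-≤ y z≤x)) (≤*⇒disjoint z≤[x∧y]*))

      extend : ∀ {z} → z ≤ x → z ≤ (y *) → z ≤ ((x ∧ y) *)
      extend z≤x z≤y* = disjoint⇒≤* (trans (∧-absorbs-≤ y z≤x) (≤*⇒disjoint z≤y*))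

  isPseudocomplementation : Congruent₁ _≈_ _* →
    (∀ x → (x ∧ (⊥ *)) ≈ x) →
    (∀ x → (x ∧ (x *)) ≈ ⊥) →
    (∀ x y → (x ∧ ((x ∧ y) *)) ≈ (x ∧ (y *))) →
    IsPseudocomplementation
  isPseudocomplementation *-cong identity₁ identity₂ identity₃ x =
    identity₂ x , greatest
    where
    greatest : ∀ z → (x ∧ z) ≈ ⊥ → z ≤ (x *)
    greatest z x∧z≈⊥ = begin
      z ∧ (x *)         ≈⟨ identity₃ z x ⟨
      z ∧ ((z ∧ x) *)   ≈⟨ ∧-cong refl (*-cong (trans (∧-comm z x) x∧z≈⊥)) ⟩
      z ∧ (⊥ *)         ≈⟨ identity₁ z ⟩
      z                 ∎

theorem3p6 : ∀ {c ℓ} (L : BoundedDistributiveLattice c ℓ) →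
    let open BoundedDistributiveLattice L in
    (_⇒_ : Op₂ Carrier) → Congruent₂ _≈_ _⇒_ →
    IsStoneLattice (λ x → x ⇒ ⊥)
      ⇔ ((∀ x → (x ∧ (⊥ ⇒ ⊥)) ≈ x)
        × (∀ x → (x ∧ (x ⇒ ⊥)) ≈ ⊥)
        × (∀ x y → (x ∧ ((x ∧ y) ⇒ ⊥)) ≈ (x ∧ (y ⇒ ⊥)))
        × (∀ x → ((x ⇒ ⊥) ∨ ((x ⇒ ⊥) ⇒ ⊥)) ≈ ⊤))
theorem3p6 L _⇒_ ⇒-cong = mk⇔
  (λ (pc , stone) → ≤⊥* pc , ∧-pseudocomplement pc , ∧-pseudocomplement-∧ pc , stone)
  (λ (e₁ , e₂ , e₃ , stone) → isPseudocomplementation (λ p → ⇒-cong p refl) e₁ e₂ e₃ , stone)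
  where
  open BoundedDistributiveLattice L
  open Pseudocomplement L (λ x → x ⇒ ⊥)
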